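{- Let $\mathbf F$ be any field. Let $P_n$ be the path with vertices $v_1,\dots,v_n$ and edges $v_iv_{i+1}$ ($1\le i<n$), and $C_n$ the cycle on $n$ vertices. If $n\ge 5$ and $w$ is a well-covered weighting of $P_n$ over $\mathbf F$, then $w(v_1)=w(v_2)$, $w(v_3)=\dots=w(v_{n-2})=0$, and $w(v_{n-1})=w(v_n)$. Moreover $wcdim(P_2,\mathbf F)=1$ and $wcdim(P_n,\mathbf F)=2$ for $n>2$. Also: (i) $wcdim(C_n,\mathbf F)=0$ if $n\ge 8$; (ii) $wcdim(C_n,\mathbf F)=1$ if $n\in\{3,5,7\}$; (iii) $wcdim(C_6,\mathbf F)=2$; (iv) $wcdim(C_4,\mathbf F)=3$.
   Context: All graphs are finite, simple and undirected. An independent set of a graph $G$ is a set of pairwise non-adjacent vertices; it is maximal if it is not properly contained in another independent set. For a field $\mathbf F$, a well-covered weighting of $G$ is a function $w:V(G)\to\mathbf F$ such that $\sum_{x\in M}w(x)$ takes the same value for every maximal independent set $M$ of $G$. The well-covered weightings form an $\mathbf F$-vector space, whose dimension is denoted $wcdim(G,\mathbf F)$. -}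

module Defs where

open import Level using (Level; _⊔_) renaming (suc to lsuc)
open import Data.Nat using (ℕ; zero; suc)
open import Data.Fin using (Fin; toℕ) renaming (zero to fzero; suc to fsuc)
open import Data.Fin.Subset using (Subset; _∈_; _⊆_; inside)
open import Data.Vec using (lookup)
open import Data.Bool using (if_then_else_)
open import Data.Product using (_×_; ∃; Σ)
open import Data.Sum using (_⊎_)
open import Relation.Nullary using (¬_)
open import Relation.Binary.PropositionalEquality using (_≡_)
open import Algebra.Bundles using (CommutativeRing)

record Field (c ℓ : Level) : Set (lsuc (c ⊔ ℓ)) where
  field
    commutativeRing : CommutativeRing c ℓ
  open CommutativeRing commutativeRing public
  field
    0≉1     : ¬ (0# ≈ 1#)
    inverse : ∀ x → ¬ (x ≈ 0#) → ∃ λ y → x * y ≈ 1#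

Graph : ℕ → Set₁
Graph n = Fin n → Fin n → Set

-- Path P_n : vertex v_{k+1} is the element k of Fin n; edges v_i v_{i+1}.
PathAdj : (n : ℕ) → Graph n
PathAdj n i j = suc (toℕ i) ≡ toℕ j ⊎ suc (toℕ j) ≡ toℕ i

-- Cycle C_n (used for n ≥ 3): path edges plus the edge v_1 v_n.
CycleAdj : (n : ℕ) → Graph n
CycleAdj n i j =
  PathAdj n i j ⊎ ((toℕ i ≡ 0 × suc (toℕ j) ≡ n) ⊎ (toℕ j ≡ 0 × suc (toℕ i) ≡ n))

Independent : ∀ {n} → Graph n → Subset n → Set
Independent E S = ∀ x y → x ∈ S → y ∈ S → ¬ E x y

MaximalIndependent : ∀ {n} → Graph n → Subset n → Set
MaximalIndependent E M =
  Independent E M × (∀ T → Independent E T → M ⊆ T → T ⊆ M)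

module _ {c ℓ : Level} (F : Field c ℓ) where
  open Field F

  sumF : ∀ {n} → (Fin n → Carrier) → Carrier
  sumF {zero}  f = 0#
  sumF {suc n} f = f fzero + sumF (λ i → f (fsuc i))

  weight : ∀ {n} → (Fin n → Carrier) → Subset n → Carrier
  weight w S = sumF (λ x → if lookup S x then w x else 0#)

  WellCovered : ∀ {n} → Graph n → (Fin n → Carrier) → Set ℓ
  WellCovered E w =
    ∀ M M' → MaximalIndependent E M → MaximalIndependent E M' → weight w M ≈ weight w M'

  lincomb : ∀ {d n} → (Fin d → Carrier) → (Fin d → Fin n → Carrier) → Fin n → Carrier
  lincomb a b x = sumF (λ i → a i * b i x)

  HasDimension : ∀ {n} → ((Fin n → Carrier) → Set ℓ) → ℕ → Set (c ⊔ ℓ)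
  HasDimension {n} W d =
    Σ (Fin d → Fin n → Carrier) λ b →
      (∀ i → W (b i))
      × (∀ a → (∀ x → lincomb a b x ≈ 0#) → ∀ i → a i ≈ 0#)
      × (∀ w → W w → ∃ λ a → ∀ x → w x ≈ lincomb a b x)

  wcdim≡ : ∀ {n} → Graph n → ℕ → Set (c ⊔ ℓ)
  wcdim≡ E d = HasDimension (WellCovered E) d

module Submission where

-- Every relation between the weights of a well-covered weighting w comes from two maximal
-- independent sets M, M′ with equal weight.  When M and M′ agree outside a short window this
-- gives a local relation (`window-exchange`): swapping a member for its neighbour yields
-- w(x) = w(x+1), swapping two members for the vertex between them yields w(x) + w(x+2) = w(x+1).
-- On paths such maximal independent sets of any length are produced by a left-to-right scan
-- (`accepts`) from reusable blocks; on cycles rotation is an automorphism, so a relation at the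
-- first vertex holds at every vertex.  Small cycles are handled by exhaustive search.
--
-- Dimensions are computed by `dimension-by-coordinates`: well-covered weightings b_i with
-- b_i(p_j) = δ_ij form a basis as soon as every well-covered weighting vanishing at the
-- coordinate vertices p_j vanishes; this uses that well-covered weightings form a subspace.
-- The basis vectors are indicators of end pairs of a path (well-covered since the ends are
-- leaves) and {1, 0, -1}-valued weightings of small cycles (checked by counting).

open import Level using (Level)
open import Defs
open import Data.Nat as ℕ using (ℕ; zero; suc; _∸_; _≤_; s≤s; z≤n)
open import Data.Nat.Properties as ℕₚ using (suc-injective)
open import Data.Fin using (Fin; toℕ; zero; suc; fromℕ; inject₁; lower₁; _↑ˡ_; _↑ʳ_)
import Data.Fin.Properties as Finₚ
open import Data.Fin.Properties
  using ( toℕ-injective; toℕ-fromℕ; toℕ-inject₁; toℕ<n; toℕ-↑ʳ; inject₁-lower₁; lower₁-inject₁′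
        ; toℕ-inject₁-≢; all?; any?)
open import Data.Fin.Subset using (Subset; _∈_; _∉_; _⊆_; _∪_; ⁅_⁆)
open import Data.Fin.Subset.Properties
  using (_∈?_; anySubset?; x∈⁅x⁆; x∈⁅y⁆⇒x≡y; x∈p∪q⁺; x∈p∪q⁻; q⊆p∪q)
open import Data.Vec using (Vec; []; _∷_; lookup; _++_; tabulate; replicate)
open import Data.Vec.Properties using ([]=⇒lookup; lookup⇒[]=; lookup∘tabulate)
open import Data.Bool using (Bool; true; false; not; _∧_; if_then_else_)
open import Data.Bool.Properties using (∧-conicalʳ; ¬-not)
open import Data.Product using (_×_; _,_; ∃; proj₁)
open import Data.Sum using (_⊎_; inj₁; inj₂)
open import Data.Empty using (⊥-elim)
open import Relation.Nullary using (¬_; Dec; yes; no; does)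
open import Relation.Binary.Definitions using (tri<; tri≈; tri>)
open import Relation.Nullary.Decidable
  using (map′; _×-dec_; _⊎-dec_; _→-dec_; ¬?; decidable-stable; dec-true; dec-false; True; toWitness)
open import Relation.Unary using (Pred; Decidable)
open import Data.Fin.Permutation using (permutation)
open import Relation.Binary.PropositionalEquality using (_≡_; _≢_; refl; sym; trans; cong; cong₂; subst)

Irreflexive : ∀ {n} → Graph n → Set
Irreflexive E = ∀ x → ¬ E x x

Dominating : ∀ {n} → Graph n → Subset n → Set
Dominating E S = ∀ x → x ∉ S → ∃ λ y → y ∈ S × (E x y ⊎ E y x)

∈⇒lookup : ∀ {n} {S : Subset n} {x} → x ∈ S → lookup S x ≡ true
∈⇒lookup = []=⇒lookup

∉⇒lookup : ∀ {n} {S : Subset n} {x} → x ∉ S → lookup S x ≡ false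
∉⇒lookup {S = S} {x} x∉ = ¬-not (λ e → x∉ (lookup⇒[]= x S e))

maximal-intro : ∀ {n} {E : Graph n} {S} → Independent E S → Dominating E S → MaximalIndependent E S
maximal-intro {E = E} {S} ind dom = ind , grow
  where
  grow : ∀ T → Independent E T → S ⊆ T → T ⊆ S
  grow T indT S⊆T {x} x∈T with x ∈? S
  ... | yes x∈S = x∈S
  ... | no x∉S with dom x x∉S
  ...   | y , y∈S , inj₁ x~y = ⊥-elim (indT x y x∈T (S⊆T y∈S) x~y)
  ...   | y , y∈S , inj₂ y~x = ⊥-elim (indT y x (S⊆T y∈S) x∈T y~x)

maximal-undominated : ∀ {n} {E : Graph n} {S} → Irreflexive E → MaximalIndependent E S →
  ∀ x → x ∉ S → ¬ (∀ y → E x y ⊎ E y x → y ∉ S)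
maximal-undominated {E = E} {S} irr (ind , max) x x∉S lonely =
  x∉S (max T indT (q⊆p∪q ⁅ x ⁆ S) (x∈p∪q⁺ (inj₁ (x∈⁅x⁆ x))))
  where
  T = ⁅ x ⁆ ∪ S
  indT : Independent E T
  indT u v u∈T v∈T u~v with x∈p∪q⁻ ⁅ x ⁆ S u∈T | x∈p∪q⁻ ⁅ x ⁆ S v∈T
  ... | inj₁ u∈x | inj₁ v∈x rewrite x∈⁅y⁆⇒x≡y x u∈x | x∈⁅y⁆⇒x≡y x v∈x = irr x u~v
  ... | inj₁ u∈x | inj₂ v∈S rewrite x∈⁅y⁆⇒x≡y x u∈x = lonely v (inj₁ u~v) v∈S
  ... | inj₂ u∈S | inj₁ v∈x rewrite x∈⁅y⁆⇒x≡y x v∈x = lonely u (inj₂ u~v) u∈S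
  ... | inj₂ u∈S | inj₂ v∈S = ind u v u∈S v∈S u~v

leaf-exactly-one : ∀ {n} {E : Graph n} {M i j} → Irreflexive E → E i j →
  (∀ y → E i y ⊎ E y i → y ≡ j) → MaximalIndependent E M → (i ∈ M × j ∉ M) ⊎ (i ∉ M × j ∈ M)
leaf-exactly-one {M = M} {i} {j} irr i~j only mis with i ∈? M | j ∈? M
... | yes i∈ | yes j∈ = ⊥-elim (proj₁ mis i j i∈ j∈ i~j)
... | yes i∈ | no j∉  = inj₁ (i∈ , j∉)
... | no i∉  | yes j∈ = inj₂ (i∉ , j∈)
... | no i∉  | no j∉  =
  ⊥-elim (maximal-undominated irr mis i i∉ (λ y i~y y∈ → j∉ (subst∈ (only y i~y) y∈)))
  where
  subst∈ : ∀ {y} → y ≡ j → y ∈ M → j ∈ M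
  subst∈ refl y∈ = y∈

maximal-supergraph : ∀ {n} {E E′ : Graph n} {S} → (∀ x y → E x y → E′ x y) →
  Independent E′ S → MaximalIndependent E S → MaximalIndependent E′ S
maximal-supergraph E⊆E′ ind′ (_ , max) =
  ind′ , λ T indT → max T (λ x y x∈ y∈ x~y → indT x y x∈ y∈ (E⊆E′ x y x~y))

relabel : ∀ {n} → (Fin n → Fin n) → Subset n → Subset n
relabel g S = tabulate (λ y → lookup S (g y))

∈-relabel⁺ : ∀ {n} {g : Fin n → Fin n} {S y} → g y ∈ S → y ∈ relabel g S
∈-relabel⁺ {g = g} {S} {y} gy∈ = lookup⇒[]= y _ (trans (lookup∘tabulate _ y) ([]=⇒lookup gy∈))

∈-relabel⁻ : ∀ {n} {g : Fin n → Fin n} {S y} → y ∈ relabel g S → g y ∈ S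
∈-relabel⁻ {g = g} {S} {y} y∈ = lookup⇒[]= (g y) S (trans (sym (lookup∘tabulate _ y)) ([]=⇒lookup y∈))

maximal-relabel : ∀ {n} {E : Graph n} (f g : Fin n → Fin n) →
  (∀ x → f (g x) ≡ x) → (∀ x → g (f x) ≡ x) →
  (∀ x y → E x y → E (f x) (f y)) → (∀ x y → E x y → E (g x) (g y)) →
  ∀ {S} → MaximalIndependent E S → MaximalIndependent E (relabel g S)
maximal-relabel {E = E} f g fg gf f-hom g-hom {S} (ind , max) = ind′ , max′
  where
  ind′ : Independent E (relabel g S)
  ind′ x y x∈ y∈ x~y = ind (g x) (g y) (∈-relabel⁻ x∈) (∈-relabel⁻ y∈) (g-hom x y x~y)
  max′ : ∀ T → Independent E T → relabel g S ⊆ T → T ⊆ relabel g S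
  max′ T indT gS⊆T {y} y∈T =
    ∈-relabel⁺ (max (relabel f T) indfT S⊆fT (∈-relabel⁺ (subst (_∈ T) (sym (fg y)) y∈T)))
    where
    indfT : Independent E (relabel f T)
    indfT x z x∈ z∈ x~z = indT (f x) (f z) (∈-relabel⁻ x∈) (∈-relabel⁻ z∈) (f-hom x z x~z)
    S⊆fT : S ⊆ relabel f T
    S⊆fT {x} x∈S = ∈-relabel⁺ (gS⊆T (∈-relabel⁺ (subst (_∈ S) (sym (gf x)) x∈S)))

module _ {n} {E : Graph n} (E? : ∀ x y → Dec (E x y)) where

  maximal-dominating : Irreflexive E → ∀ {S} → MaximalIndependent E S → Dominating E S
  maximal-dominating irr {S} mis x x∉S with any? (λ y → (y ∈? S) ×-dec (E? x y ⊎-dec E? y x))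
  ... | yes (y , y∈S , x~y) = y , y∈S , x~y
  ... | no none = ⊥-elim (maximal-undominated irr mis x x∉S (λ y x~y y∈S → none (y , y∈S , x~y)))

  maximal? : Irreflexive E → ∀ S → Dec (MaximalIndependent E S)
  maximal? irr S = map′ (λ (ind , dom) → maximal-intro ind dom)
                        (λ mis → proj₁ mis , maximal-dominating irr mis)
                        (independent? ×-dec dominating?)
    where
    independent? = all? λ x → all? λ y → (x ∈? S) →-dec ((y ∈? S) →-dec ¬? (E? x y))
    dominating?  = all? λ x → ¬? (x ∈? S) →-dec any? (λ y → (y ∈? S) ×-dec (E? x y ⊎-dec E? y x))

allSubsets? : ∀ {n ℓ} {P : Pred (Subset n) ℓ} → Decidable P → Dec (∀ S → P S)
allSubsets? P? = map′ (λ ¬∃¬ S → decidable-stable (P? S) (λ ¬PS → ¬∃¬ (S , ¬PS)))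
                      (λ ∀P (S , ¬PS) → ¬PS (∀P S))
                      (¬? (anySubset? (λ S → ¬? (P? S))))

-- Paths.  Maximal independent sets of P_n are recognised by a left-to-right scan, which lets us
-- build them from blocks of arbitrary length.

path-irreflexive : ∀ {n} → Irreflexive (PathAdj n)
path-irreflexive x (inj₁ e) = ℕₚ.1+n≢n e
path-irreflexive x (inj₂ e) = ℕₚ.1+n≢n e

-- `accepts p d v` scans the membership vector v of the vertices following a vertex whose
-- membership is p and which still awaits a dominating right neighbour iff d.
accepts : ∀ {n} → Bool → Bool → Vec Bool n → Bool
accepts p d []          = not d
accepts p d (true ∷ v)  = not p ∧ accepts true false v
accepts p d (false ∷ v) = not d ∧ accepts false (not p) v

accepts-tail : ∀ {n} p d b (v : Vec Bool n) → accepts p d (b ∷ v) ≡ true →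
               accepts b (not b ∧ not p) v ≡ true
accepts-tail p d true  v acc = ∧-conicalʳ _ _ acc
accepts-tail p d false v acc = ∧-conicalʳ _ _ acc

accepts-independent : ∀ {n} p d (v : Vec Bool n) → accepts p d v ≡ true →
  ∀ x y → lookup v x ≡ true → lookup v y ≡ true → ¬ PathAdj n x y
accepts-independent p d (b ∷ v) acc zero zero _ _ (inj₁ ())
accepts-independent p d (b ∷ v) acc zero zero _ _ (inj₂ ())
accepts-independent p d (true ∷ true ∷ v) acc zero (suc zero) _ _ _
  with accepts-tail p d true (true ∷ v) acc
... | ()
accepts-independent p d (true ∷ true ∷ v) acc (suc zero) zero _ _ _
  with accepts-tail p d true (true ∷ v) acc
... | ()
accepts-independent p d (b ∷ v) acc zero (suc (suc y)) _ _ (inj₁ ())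
accepts-independent p d (b ∷ v) acc zero (suc (suc y)) _ _ (inj₂ ())
accepts-independent p d (b ∷ v) acc (suc (suc x)) zero _ _ (inj₁ ())
accepts-independent p d (b ∷ v) acc (suc (suc x)) zero _ _ (inj₂ ())
accepts-independent p d (b ∷ v) acc (suc x) (suc y) x∈ y∈ (inj₁ e) =
  accepts-independent _ _ v (accepts-tail p d b v acc) x y x∈ y∈ (inj₁ (suc-injective e))
accepts-independent p d (b ∷ v) acc (suc x) (suc y) x∈ y∈ (inj₂ e) =
  accepts-independent _ _ v (accepts-tail p d b v acc) x y x∈ y∈ (inj₂ (suc-injective e))

accepts-pending : ∀ {n p} b (v : Vec Bool n) → accepts p true (b ∷ v) ≡ true → b ≡ true
accepts-pending true v acc = refl

accepts-dominating : ∀ {n} p d (v : Vec Bool n) → accepts p d v ≡ true →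
  ∀ x → lookup v x ≡ false →
  (toℕ x ≡ 0 × p ≡ true) ⊎ ∃ λ y → lookup v y ≡ true × PathAdj n x y
accepts-dominating true d (false ∷ v) acc zero _ = inj₁ (refl , refl)
accepts-dominating false false (false ∷ []) () zero _
accepts-dominating false true  (false ∷ []) () zero _
accepts-dominating false d (false ∷ b ∷ v) acc zero _
  with accepts-pending b v (accepts-tail false d false (b ∷ v) acc)
... | refl = inj₂ (suc zero , refl , inj₁ refl)
accepts-dominating p d (b ∷ v) acc (suc x) x∉
  with accepts-dominating _ _ v (accepts-tail p d b v acc) x x∉
... | inj₁ (x≡0 , refl) = inj₂ (zero , refl , inj₂ (cong suc (sym x≡0)))
... | inj₂ (y , y∈ , x~y) = inj₂ (suc y , y∈ , shift x~y)
  where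
  shift : ∀ {m} {x y : Fin m} → PathAdj m x y → PathAdj (suc m) (suc x) (suc y)
  shift (inj₁ e) = inj₁ (cong suc e)
  shift (inj₂ e) = inj₂ (cong suc e)

accepts-maximal : ∀ {n} (v : Vec Bool n) → accepts false false v ≡ true →
  MaximalIndependent (PathAdj n) v
accepts-maximal v acc = maximal-intro independent dominating
  where
  independent : Independent (PathAdj _) v
  independent x y x∈ y∈ = accepts-independent false false v acc x y (∈⇒lookup x∈) (∈⇒lookup y∈)
  dominating : Dominating (PathAdj _) v
  dominating x x∉ with accepts-dominating false false v acc x (∉⇒lookup x∉)
  ... | inj₂ (y , y∈ , x~y) = y , lookup⇒[]= y v y∈ , inj₁ x~y

-- A margin of length
-- k ≠ 1 can be filled on either side of a window; `opening` returns the scan to its initial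
-- state, `closing` completes it from any state that does not await domination.
data Margin : ℕ → Set where
  none : Margin 0
  wide : ∀ k → Margin (2 ℕ.+ k)

alternating : (k : ℕ) → Vec Bool (suc k)
alternating zero          = true ∷ []
alternating (suc zero)    = true ∷ false ∷ []
alternating (suc (suc k)) = true ∷ false ∷ alternating k

alternating-accepted : ∀ k d → accepts false d (alternating k) ≡ true
alternating-accepted zero          d = refl
alternating-accepted (suc zero)    d = refl
alternating-accepted (suc (suc k)) d = alternating-accepted k false

opening : ∀ {a} → Margin a → Vec Bool a
opening none                   = []
opening (wide zero)            = true ∷ false ∷ []
opening (wide (suc zero))      = false ∷ true ∷ false ∷ []
opening (wide (suc (suc k)))   = true ∷ false ∷ opening (wide k)

opening-resets : ∀ {a n} (m : Margin a) (v : Vec Bool n) →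
  accepts false false (opening m ++ v) ≡ accepts false false v
opening-resets none                 v = refl
opening-resets (wide zero)          v = refl
opening-resets (wide (suc zero))    v = refl
opening-resets (wide (suc (suc k))) v = opening-resets (wide k) v

closing : ∀ {b} → Margin b → Vec Bool b
closing none     = []
closing (wide k) = false ∷ alternating k

closing-accepted : ∀ {b} p (m : Margin b) → accepts p false (closing m) ≡ true
closing-accepted p none     = refl
closing-accepted true  (wide k) = alternating-accepted k false
closing-accepted false (wide k) = alternating-accepted k true

framed : ∀ {a k b} → Margin a → Vec Bool k → Margin b → Subset (a ℕ.+ (k ℕ.+ b))
framed ma X mb = opening ma ++ (X ++ closing mb)

framed-maximal : ∀ {a k b} (ma : Margin a) (X : Vec Bool k) (mb : Margin b) →
  accepts false false (X ++ closing mb) ≡ true → MaximalIndependent (PathAdj _) (framed ma X mb)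
framed-maximal ma X mb acc = accepts-maximal _ (trans (opening-resets ma _) acc)

path-first-leaf : ∀ {m} y → PathAdj (2 ℕ.+ m) zero y ⊎ PathAdj (2 ℕ.+ m) y zero → y ≡ suc zero
path-first-leaf (suc zero) _ = refl
path-first-leaf (suc (suc y)) (inj₁ (inj₁ ()))
path-first-leaf (suc (suc y)) (inj₁ (inj₂ ()))
path-first-leaf (suc (suc y)) (inj₂ (inj₁ ()))
path-first-leaf (suc (suc y)) (inj₂ (inj₂ ()))
path-first-leaf {m} zero (inj₁ x~x) = ⊥-elim (path-irreflexive {2 ℕ.+ m} zero x~x)
path-first-leaf {m} zero (inj₂ x~x) = ⊥-elim (path-irreflexive {2 ℕ.+ m} zero x~x)

path-last-leaf : ∀ {m} y → PathAdj (2 ℕ.+ m) (fromℕ (suc m)) y ⊎ PathAdj (2 ℕ.+ m) y (fromℕ (suc m)) →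
  y ≡ inject₁ (fromℕ m)
path-last-leaf {m} y adj =
  toℕ-injective (trans (neighbour adj) (sym (trans (toℕ-inject₁ (fromℕ m)) (toℕ-fromℕ m))))
  where
  beyond : ¬ suc (toℕ (fromℕ (suc m))) ≡ toℕ y
  beyond e = ℕₚ.<⇒≱ (toℕ<n y) (ℕₚ.≤-reflexive (trans (cong suc (sym (toℕ-fromℕ (suc m)))) e))
  below : suc (toℕ y) ≡ toℕ (fromℕ (suc m)) → toℕ y ≡ m
  below e = suc-injective (trans e (toℕ-fromℕ (suc m)))
  neighbour : PathAdj (2 ℕ.+ m) (fromℕ (suc m)) y ⊎ PathAdj (2 ℕ.+ m) y (fromℕ (suc m)) → toℕ y ≡ m
  neighbour (inj₁ (inj₁ e)) = ⊥-elim (beyond e)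
  neighbour (inj₁ (inj₂ e)) = below e
  neighbour (inj₂ (inj₁ e)) = below e
  neighbour (inj₂ (inj₂ e)) = ⊥-elim (beyond e)

toℕ-shifted : ∀ a {m} (i : Fin m) → toℕ (a ↑ʳ i) ≡ toℕ i ℕ.+ a
toℕ-shifted a i = trans (toℕ-↑ʳ a i) (ℕₚ.+-comm a (toℕ i))

vertexAt : ∀ {n} a k → a ℕ.+ suc k ≡ n → Fin n
vertexAt a k refl = a ↑ʳ zero

toℕ-vertexAt : ∀ {n} a k (e : a ℕ.+ suc k ≡ n) → toℕ (vertexAt a k e) ≡ a
toℕ-vertexAt a k refl = toℕ-shifted a zero

path-vertex-cases : ∀ {k} (x : Fin (4 ℕ.+ k)) →
  toℕ x ≡ 0 ⊎ toℕ x ≡ 1 ⊎ (2 ≤ toℕ x × toℕ x ℕ.+ 3 ≤ 4 ℕ.+ k)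
  ⊎ toℕ x ≡ 2 ℕ.+ k ⊎ toℕ x ≡ 3 ℕ.+ k
path-vertex-cases zero          = inj₁ refl
path-vertex-cases (suc zero)    = inj₂ (inj₁ refl)
path-vertex-cases {k} (suc (suc y)) with ℕₚ.<-cmp (toℕ y) k
... | tri< y<k _ _ = inj₂ (inj₂ (inj₁ (s≤s (s≤s z≤n) , s≤s (s≤s y+3≤k+2))))
  where
  y+3≤k+2 : toℕ y ℕ.+ 3 ≤ 2 ℕ.+ k
  y+3≤k+2 = ℕₚ.≤-trans (ℕₚ.≤-reflexive (ℕₚ.+-comm (toℕ y) 3)) (s≤s (s≤s y<k))
... | tri≈ _ y≡k _ = inj₂ (inj₂ (inj₂ (inj₁ (cong (λ t → suc (suc t)) y≡k))))
... | tri> _ _ k<y = inj₂ (inj₂ (inj₂ (inj₂ (cong (λ t → suc (suc t)) y≡1+k))))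
  where
  y≡1+k : toℕ y ≡ suc k
  y≡1+k = ℕₚ.≤-antisym (ℕ.s≤s⁻¹ (toℕ<n y)) k<y

-- Cycles.  C_n is the graph of the predecessor map, so rotation is an automorphism.

prev : ∀ {m} → Fin (suc m) → Fin (suc m)
prev {m} zero = fromℕ m
prev (suc i)  = inject₁ i

next : ∀ {m} → Fin (suc m) → Fin (suc m)
next {m} x with m ℕₚ.≟ toℕ x
... | yes _   = zero
... | no m≢x = suc (lower₁ x m≢x)

prev-next : ∀ {m} (x : Fin (suc m)) → prev (next x) ≡ x
prev-next {m} x with m ℕₚ.≟ toℕ x
... | yes m≡x = toℕ-injective (trans (toℕ-fromℕ m) m≡x)
... | no m≢x  = inject₁-lower₁ x m≢x

next-prev : ∀ {m} (x : Fin (suc m)) → next (prev x) ≡ x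
next-prev {m} zero with m ℕₚ.≟ toℕ (fromℕ m)
... | yes _   = refl
... | no m≢m = ⊥-elim (m≢m (sym (toℕ-fromℕ m)))
next-prev {suc m} (suc i) with suc m ℕₚ.≟ toℕ (inject₁ i)
... | yes e   = ⊥-elim (toℕ-inject₁-≢ i e)
... | no m≢i = cong suc (lower₁-inject₁′ i m≢i)

prev-spec : ∀ {m} (x y : Fin (suc m)) →
  x ≡ prev y → suc (toℕ x) ≡ toℕ y ⊎ (toℕ y ≡ 0 × suc (toℕ x) ≡ suc m)
prev-spec {m} x zero    refl = inj₂ (refl , cong suc (toℕ-fromℕ m))
prev-spec     x (suc i) refl = inj₁ (cong suc (toℕ-inject₁ i))

prev-spec⁻ : ∀ {m} (x y : Fin (suc m)) →
  suc (toℕ x) ≡ toℕ y ⊎ (toℕ y ≡ 0 × suc (toℕ x) ≡ suc m) → x ≡ prev y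
prev-spec⁻ x (suc i) (inj₁ e)        = toℕ-injective (trans (suc-injective e) (sym (toℕ-inject₁ i)))
prev-spec⁻ {m} x zero (inj₂ (_ , e)) = toℕ-injective (trans (suc-injective e) (sym (toℕ-fromℕ m)))

cycle-adjacent⇒prev : ∀ {m} (x y : Fin (suc m)) → CycleAdj (suc m) x y → x ≡ prev y ⊎ y ≡ prev x
cycle-adjacent⇒prev x y (inj₁ (inj₁ e))        = inj₁ (prev-spec⁻ x y (inj₁ e))
cycle-adjacent⇒prev x y (inj₁ (inj₂ e))        = inj₂ (prev-spec⁻ y x (inj₁ e))
cycle-adjacent⇒prev x y (inj₂ (inj₁ (x0 , e))) = inj₂ (prev-spec⁻ y x (inj₂ (x0 , e)))
cycle-adjacent⇒prev x y (inj₂ (inj₂ (y0 , e))) = inj₁ (prev-spec⁻ x y (inj₂ (y0 , e)))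

prev⇒cycle-adjacent : ∀ {m} (x y : Fin (suc m)) → x ≡ prev y ⊎ y ≡ prev x → CycleAdj (suc m) x y
prev⇒cycle-adjacent x y (inj₁ x≡) with prev-spec x y x≡
... | inj₁ e  = inj₁ (inj₁ e)
... | inj₂ p  = inj₂ (inj₂ p)
prev⇒cycle-adjacent x y (inj₂ y≡) with prev-spec y x y≡
... | inj₁ e  = inj₁ (inj₂ e)
... | inj₂ p  = inj₂ (inj₁ p)

commutes-with-prev : ∀ {m} (f : Fin (suc m) → Fin (suc m)) → (∀ x → f (prev x) ≡ prev (f x)) →
  ∀ x y → CycleAdj (suc m) x y → CycleAdj (suc m) (f x) (f y)
commutes-with-prev f comm x y x~y with cycle-adjacent⇒prev x y x~y
... | inj₁ refl = prev⇒cycle-adjacent (f x) (f y) (inj₁ (comm y))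
... | inj₂ refl = prev⇒cycle-adjacent (f x) (f y) (inj₂ (comm x))

next-automorphism : ∀ {m} x y → CycleAdj (suc m) x y → CycleAdj (suc m) (next x) (next y)
next-automorphism = commutes-with-prev next (λ x → trans (next-prev x) (sym (prev-next x)))

prev-automorphism : ∀ {m} x y → CycleAdj (suc m) x y → CycleAdj (suc m) (prev x) (prev y)
prev-automorphism = commutes-with-prev prev (λ _ → refl)

prev-no-fixed-point : ∀ {m} → 1 ≤ m → (x : Fin (suc m)) → ¬ x ≡ prev x
prev-no-fixed-point (s≤s _) zero ()
prev-no-fixed-point _ (suc i) e = ℕₚ.1+n≢n (trans (cong toℕ e) (toℕ-inject₁ i))

cycle-irreflexive : ∀ {m} → 1 ≤ m → Irreflexive (CycleAdj (suc m))
cycle-irreflexive 1≤m x x~x with cycle-adjacent⇒prev x x x~x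
... | inj₁ e = prev-no-fixed-point 1≤m x e
... | inj₂ e = prev-no-fixed-point 1≤m x e

cycle-adjacent? : ∀ n (x y : Fin n) → Dec (CycleAdj n x y)
cycle-adjacent? n x y =
  ((suc (toℕ x) ℕₚ.≟ toℕ y) ⊎-dec (suc (toℕ y) ℕₚ.≟ toℕ x))
  ⊎-dec (((toℕ x ℕₚ.≟ 0) ×-dec (suc (toℕ y) ℕₚ.≟ n))
         ⊎-dec ((toℕ y ℕₚ.≟ 0) ×-dec (suc (toℕ x) ℕₚ.≟ n)))

cycle-maximal? : ∀ m S → Dec (MaximalIndependent (CycleAdj (2 ℕ.+ m)) S)
cycle-maximal? m = maximal? (cycle-adjacent? (2 ℕ.+ m)) (cycle-irreflexive (s≤s z≤n))

CheckedOnMaximal : ∀ m {ℓ} {P : Pred (Subset (2 ℕ.+ m)) ℓ} → Decidable P → Set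
CheckedOnMaximal m P? = True (allSubsets? (λ S → cycle-maximal? m S →-dec P? S))

cycle-search : ∀ m {ℓ} {P : Pred (Subset (2 ℕ.+ m)) ℓ} (P? : Decidable P) → CheckedOnMaximal m P? →
  ∀ S → MaximalIndependent (CycleAdj (2 ℕ.+ m)) S → P S
cycle-search m P? = toWitness

-- A maximal independent set of the path avoiding the last vertex is one of the cycle:
-- the only additional edge joins the first and the last vertex.
path⇒cycle-maximal : ∀ {m} (S : Subset (suc m)) → lookup S (fromℕ m) ≡ false →
  MaximalIndependent (PathAdj (suc m)) S → MaximalIndependent (CycleAdj (suc m)) S
path⇒cycle-maximal {m} S last∉ mis@(ind , _) = maximal-supergraph (λ _ _ → inj₁) ind′ mis
  where
  not-last : ∀ y → y ∈ S → ¬ suc (toℕ y) ≡ suc m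
  not-last y y∈ e with toℕ-injective (trans (suc-injective e) (sym (toℕ-fromℕ m)))
  ... | refl with trans (sym ([]=⇒lookup y∈)) last∉
  ...   | ()
  ind′ : Independent (CycleAdj (suc m)) S
  ind′ x y x∈ y∈ (inj₁ x~y)             = ind x y x∈ y∈ x~y
  ind′ x y x∈ y∈ (inj₂ (inj₁ (_ , e))) = not-last y y∈ e
  ind′ x y x∈ y∈ (inj₂ (inj₂ (_ , e))) = not-last x x∈ e

-- T F T F … of length k + 4, with one F doubled when k is odd: it completes the scan after
-- a non-member and ends with a non-member
alternating-open : (k : ℕ) → Vec Bool (4 ℕ.+ k)
alternating-open zero          = true ∷ false ∷ true ∷ false ∷ []
alternating-open (suc zero)    = true ∷ false ∷ false ∷ true ∷ false ∷ []
alternating-open (suc (suc k)) = true ∷ false ∷ alternating-open k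

alternating-open-accepted : ∀ k d → accepts false d (alternating-open k) ≡ true
alternating-open-accepted zero          d = refl
alternating-open-accepted (suc zero)    d = refl
alternating-open-accepted (suc (suc k)) d = alternating-open-accepted k false

alternating-open-last : ∀ k → lookup (alternating-open k) (fromℕ (3 ℕ.+ k)) ≡ false
alternating-open-last zero          = refl
alternating-open-last (suc zero)    = refl
alternating-open-last (suc (suc k)) = alternating-open-last k

suc-≢ : ∀ {n} {x y : Fin n} → x ≢ y → suc x ≢ suc y
suc-≢ x≢y e = x≢y (Finₚ.suc-injective e)

-- Weightings with values in {1, 0, -1}, given by sign vectors; over them the weight of a set is
-- determined by how many of its members carry each sign.
data Sign : Set where
  plus nil minus : Sign

positives negatives : ∀ {n} → Vec Sign n → Subset n → ℕ
positives []          []          = 0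
positives (plus ∷ s)  (true ∷ S)  = suc (positives s S)
positives (nil ∷ s)   (true ∷ S)  = positives s S
positives (minus ∷ s) (true ∷ S)  = positives s S
positives (_ ∷ s)     (false ∷ S) = positives s S
negatives []          []          = 0
negatives (minus ∷ s) (true ∷ S)  = suc (negatives s S)
negatives (nil ∷ s)   (true ∷ S)  = negatives s S
negatives (plus ∷ s)  (true ∷ S)  = negatives s S
negatives (_ ∷ s)     (false ∷ S) = negatives s S

Balanced : ∀ {n} → Vec Sign n → ℕ → ℕ → Subset n → Set
Balanced s p q S = positives s S ℕ.+ q ≡ p ℕ.+ negatives s S

balanced? : ∀ {n} (s : Vec Sign n) p q → Decidable (Balanced s p q)
balanced? s p q S = positives s S ℕ.+ q ℕₚ.≟ p ℕ.+ negatives s S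

module _ {c ℓ : Level} (F : Field c ℓ) where

  open Field F renaming (refl to ≈-refl; sym to ≈-sym; trans to ≈-trans; reflexive to ≈-reflexive)
    hiding (zero)
  open import Algebra.Properties.Semiring.Sum semiring
    using (sum; sum-cong-≋; sum-cong-≗; ∑-distrib-+; *-distribˡ-sum; sum-permute)
  open import Algebra.Properties.Group +-group
    using (∙-cancelˡ; ∙-cancelʳ; identityˡ-unique; identityʳ-unique; x∙y⁻¹≈ε⇒x≈y)
  open import Algebra.Properties.Ring ring using (-1*x≈-x)
  open import Algebra.Properties.AbelianGroup +-abelianGroup using (⁻¹-∙-comm)
  open import Algebra.Properties.CommutativeSemigroup +-commutativeSemigroup using (x∙yz≈y∙xz)
  open import Algebra.Properties.Monoid.Mult +-monoid renaming (_×_ to _·_) using (×-homo-+)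
  open import Relation.Binary.Reasoning.Setoid setoid

  contribution : ∀ {n} → (Fin n → Carrier) → Subset n → Fin n → Carrier
  contribution w S x = if lookup S x then w x else 0#

  sumF≡sum : ∀ {n} (f : Fin n → Carrier) → sumF F f ≡ sum f
  sumF≡sum {zero}  f = refl
  sumF≡sum {suc n} f = cong (f zero +_) (sumF≡sum (λ x → f (suc x)))

  weight≡sum : ∀ {n} (w : Fin n → Carrier) S → weight F w S ≡ sum (contribution w S)
  weight≡sum w S = sumF≡sum (contribution w S)

  sumF-vanishes : ∀ {n} (f : Fin n → Carrier) → (∀ x → f x ≈ 0#) → sumF F f ≈ 0#
  sumF-vanishes {zero}  f _ = ≈-refl
  sumF-vanishes {suc n} f f≈0 =
    ≈-trans (+-cong (f≈0 zero) (sumF-vanishes (λ x → f (suc x)) (λ x → f≈0 (suc x)))) (+-identityˡ 0#)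

  contribution-vanishes : ∀ {n} (w : Fin n → Carrier) S x → w x ≈ 0# → contribution w S x ≈ 0#
  contribution-vanishes w S x w≈0 with lookup S x
  ... | true  = w≈0
  ... | false = ≈-refl

  sumF-single : ∀ {n} (f : Fin n → Carrier) j → (∀ x → x ≢ j → f x ≈ 0#) → sumF F f ≈ f j
  sumF-single f zero    off = ≈-trans (+-congˡ (sumF-vanishes _ (λ x → off (suc x) λ ()))) (+-identityʳ _)
  sumF-single f (suc j) off = ≈-trans (+-cong (off zero λ ()) rest) (+-identityˡ _)
    where
    rest : sumF F (λ x → f (suc x)) ≈ f (suc j)
    rest = sumF-single (λ x → f (suc x)) j (λ x x≢j → off (suc x) (suc-≢ x≢j))

  sumF-pair : ∀ {n} (f : Fin n → Carrier) i j → i ≢ j → (∀ x → x ≢ i → x ≢ j → f x ≈ 0#) →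
    sumF F f ≈ f i + f j
  sumF-pair f zero    zero    i≢j _   = ⊥-elim (i≢j refl)
  sumF-pair f zero    (suc j) _   off =
    +-congˡ (sumF-single (λ x → f (suc x)) j (λ x x≢j → off (suc x) (λ ()) (suc-≢ x≢j)))
  sumF-pair f (suc i) zero    _   off = ≈-trans (+-congˡ rest) (+-comm _ _)
    where
    rest : sumF F (λ x → f (suc x)) ≈ f (suc i)
    rest = sumF-single (λ x → f (suc x)) i (λ x x≢i → off (suc x) (suc-≢ x≢i) (λ ()))
  sumF-pair f (suc i) (suc j) i≢j off = ≈-trans (+-cong (off zero (λ ()) (λ ())) rest) (+-identityˡ _)
    where
    rest : sumF F (λ x → f (suc x)) ≈ f (suc i) + f (suc j)
    rest = sumF-pair (λ x → f (suc x)) i j (λ e → i≢j (cong suc e))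
                     (λ x x≢i x≢j → off (suc x) (suc-≢ x≢i) (suc-≢ x≢j))

  ≈-toℕ : ∀ {n} (w : Fin n → Carrier) {x y} → toℕ x ≡ toℕ y → w x ≈ w y
  ≈-toℕ w e = ≈-reflexive (cong w (toℕ-injective e))

  vanishes-by : ∀ {x y z} → x ≈ 0# → y ≈ 0# → x + z ≈ y → z ≈ 0#
  vanishes-by {x} {y} {z} x≈0 y≈0 e = begin
    z       ≈⟨ ≈-sym (+-identityˡ z) ⟩
    0# + z  ≈⟨ +-congʳ (≈-sym x≈0) ⟩
    x + z   ≈⟨ e ⟩
    y       ≈⟨ y≈0 ⟩
    0#      ∎

  weight-+ : ∀ {n} (f g : Fin n → Carrier) S →
    weight F (λ x → f x + g x) S ≈ weight F f S + weight F g S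
  weight-+ f g S = begin
    weight F (λ x → f x + g x) S            ≡⟨ weight≡sum _ S ⟩
    sum (contribution (λ x → f x + g x) S)  ≈⟨ sum-cong-≋ (λ x → split (lookup S x)) ⟩
    sum (λ x → f̂ x + ĝ x)                   ≈⟨ ∑-distrib-+ f̂ ĝ ⟩
    sum f̂ + sum ĝ                           ≡⟨ sym (cong₂ _+_ (weight≡sum f S) (weight≡sum g S)) ⟩
    weight F f S + weight F g S             ∎
    where
    f̂ = contribution f S
    ĝ = contribution g S
    split : ∀ {u v} b → (if b then u + v else 0#) ≈ (if b then u else 0#) + (if b then v else 0#)
    split true  = ≈-refl
    split false = ≈-sym (+-identityˡ 0#)

  weight-* : ∀ {n} a (f : Fin n → Carrier) S → weight F (λ x → a * f x) S ≈ a * weight F f S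
  weight-* a f S = begin
    weight F (λ x → a * f x) S            ≡⟨ weight≡sum _ S ⟩
    sum (contribution (λ x → a * f x) S)  ≈⟨ sum-cong-≋ (λ x → pull (lookup S x)) ⟩
    sum (λ x → a * contribution f S x)    ≈⟨ ≈-sym (*-distribˡ-sum a (contribution f S)) ⟩
    a * sum (contribution f S)            ≡⟨ cong (a *_) (sym (weight≡sum f S)) ⟩
    a * weight F f S                      ∎
    where
    pull : ∀ {u} b → (if b then a * u else 0#) ≈ a * (if b then u else 0#)
    pull true  = ≈-refl
    pull false = ≈-sym (zeroʳ a)

  weight-0 : ∀ {n} (S : Subset n) → weight F (λ _ → 0#) S ≈ 0#
  weight-0 S = sumF-vanishes _ (λ x → contribution-vanishes (λ _ → 0#) S x ≈-refl)

  wellCovered-+ : ∀ {n} {E : Graph n} {f g} → WellCovered F E f → WellCovered F E g →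
    WellCovered F E (λ x → f x + g x)
  wellCovered-+ {f = f} {g} wf wg M M′ m m′ = begin
    weight F (λ x → f x + g x) M   ≈⟨ weight-+ f g M ⟩
    weight F f M + weight F g M    ≈⟨ +-cong (wf M M′ m m′) (wg M M′ m m′) ⟩
    weight F f M′ + weight F g M′  ≈⟨ ≈-sym (weight-+ f g M′) ⟩
    weight F (λ x → f x + g x) M′  ∎

  wellCovered-* : ∀ {n} {E : Graph n} {f} a → WellCovered F E f → WellCovered F E (λ x → a * f x)
  wellCovered-* {f = f} a wf M M′ m m′ = begin
    weight F (λ x → a * f x) M   ≈⟨ weight-* a f M ⟩
    a * weight F f M             ≈⟨ *-congˡ (wf M M′ m m′) ⟩
    a * weight F f M′            ≈⟨ ≈-sym (weight-* a f M′) ⟩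
    weight F (λ x → a * f x) M′  ∎

  wellCovered-lincomb : ∀ {n d} {E : Graph n} (a : Fin d → Carrier) (b : Fin d → Fin n → Carrier) →
    (∀ i → WellCovered F E (b i)) → WellCovered F E (lincomb F a b)
  wellCovered-lincomb {d = zero} a b wb M M′ _ _ = ≈-trans (weight-0 M) (≈-sym (weight-0 M′))
  wellCovered-lincomb {d = suc d} a b wb =
    wellCovered-+ (wellCovered-* (a zero) (wb zero))
                  (wellCovered-lincomb (λ i → a (suc i)) (λ i → b (suc i)) (λ i → wb (suc i)))

  δ : ∀ {d} → Fin d → Fin d → Carrier
  δ zero    zero    = 1#
  δ zero    (suc _) = 0#
  δ (suc _) zero    = 0#
  δ (suc i) (suc j) = δ i j

  δ-diagonal : ∀ {d} (j : Fin d) → δ j j ≡ 1#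
  δ-diagonal zero    = refl
  δ-diagonal (suc j) = δ-diagonal j

  δ-off-diagonal : ∀ {d} (i j : Fin d) → i ≢ j → δ i j ≡ 0#
  δ-off-diagonal zero    zero    i≢j = ⊥-elim (i≢j refl)
  δ-off-diagonal zero    (suc j) _   = refl
  δ-off-diagonal (suc i) zero    _   = refl
  δ-off-diagonal (suc i) (suc j) i≢j = δ-off-diagonal i j (λ e → i≢j (cong suc e))

  sum-δ : ∀ {d} (a c : Fin d → Carrier) j → (∀ i → c i ≈ δ i j) → sumF F (λ i → a i * c i) ≈ a j
  sum-δ a c j c≈δ = begin
    sumF F (λ i → a i * c i) ≈⟨ sumF-single _ j off ⟩
    a j * c j                ≈⟨ *-congˡ (≈-trans (c≈δ j) (≈-reflexive (δ-diagonal j))) ⟩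
    a j * 1#                 ≈⟨ *-identityʳ _ ⟩
    a j                      ∎
    where
    off : ∀ i → i ≢ j → a i * c i ≈ 0#
    off i i≢j = ≈-trans (*-congˡ (≈-trans (c≈δ i) (≈-reflexive (δ-off-diagonal i j i≢j)))) (zeroʳ _)

  dimension-by-coordinates : ∀ {n d} (E : Graph n) (b : Fin d → Fin n → Carrier) (p : Fin d → Fin n) →
    (∀ i → WellCovered F E (b i)) → (∀ i j → b i (p j) ≈ δ i j) →
    (∀ w → WellCovered F E w → (∀ j → w (p j) ≈ 0#) → ∀ x → w x ≈ 0#) →
    wcdim≡ F E d
  dimension-by-coordinates E b p b-wc b-δ determined = b , b-wc , independent , spanning
    where
    at-coordinate : ∀ a j → lincomb F a b (p j) ≈ a j
    at-coordinate a j = sum-δ a (λ i → b i (p j)) j (λ i → b-δ i j)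
    independent : ∀ a → (∀ x → lincomb F a b x ≈ 0#) → ∀ j → a j ≈ 0#
    independent a vanishes j = ≈-trans (≈-sym (at-coordinate a j)) (vanishes (p j))
    spanning : ∀ w → WellCovered F E w → ∃ λ a → ∀ x → w x ≈ lincomb F a b x
    spanning w w-wc = a , λ x → x∙y⁻¹≈ε⇒x≈y _ _ (≈-trans (+-congˡ (≈-sym (-1*x≈-x _))) (residual≈0 x))
      where
      a : _ → Carrier
      a j = w (p j)
      residual : _ → Carrier
      residual x = w x + (- 1#) * lincomb F a b x
      residual-wc : WellCovered F E residual
      residual-wc = wellCovered-+ w-wc (wellCovered-* (- 1#) (wellCovered-lincomb a b b-wc))
      residual-coords : ∀ j → residual (p j) ≈ 0#
      residual-coords j = begin
        w (p j) + (- 1#) * lincomb F a b (p j)  ≈⟨ +-congˡ (*-congˡ (at-coordinate a j)) ⟩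
        w (p j) + (- 1#) * w (p j)              ≈⟨ +-congˡ (-1*x≈-x _) ⟩
        w (p j) - w (p j)                       ≈⟨ -‿inverseʳ _ ⟩
        0#                                      ∎
      residual≈0 : ∀ x → residual x ≈ 0#
      residual≈0 = determined residual residual-wc residual-coords

  weight-relabel : ∀ {n} (f g : Fin n → Fin n) → (∀ x → f (g x) ≡ x) → (∀ x → g (f x) ≡ x) →
    (w : Fin n → Carrier) (S : Subset n) → weight F (λ x → w (f x)) S ≈ weight F w (relabel g S)
  weight-relabel f g fg gf w S = begin
    weight F (λ x → w (f x)) S            ≡⟨ weight≡sum _ S ⟩
    sum (contribution (λ x → w (f x)) S)  ≡⟨ sum-cong-≗ (λ x → cong (λ b → if b then w (f x) else 0#)
                                                             relabelled) ⟩
    sum (λ x → ŵ (f x))                   ≈⟨ ≈-sym (sum-permute ŵ (permutation f g fg gf)) ⟩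
    sum ŵ                                 ≡⟨ sym (weight≡sum w (relabel g S)) ⟩
    weight F w (relabel g S)              ∎
    where
    ŵ = contribution w (relabel g S)
    relabelled : ∀ {x} → lookup S x ≡ lookup (relabel g S) (f x)
    relabelled {x} = sym (trans (lookup∘tabulate _ (f x)) (cong (lookup S) (gf x)))

  wellCovered-automorphism : ∀ {n} {E : Graph n} (f g : Fin n → Fin n) →
    (∀ x → f (g x) ≡ x) → (∀ x → g (f x) ≡ x) →
    (∀ x y → E x y → E (f x) (f y)) → (∀ x y → E x y → E (g x) (g y)) →
    ∀ w → WellCovered F E w → WellCovered F E (λ x → w (f x))
  wellCovered-automorphism f g fg gf f-hom g-hom w w-wc M M′ m m′ = begin
    weight F (λ x → w (f x)) M    ≈⟨ weight-relabel f g fg gf w M ⟩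
    weight F w (relabel g M)      ≈⟨ w-wc _ _ (relabelled m) (relabelled m′) ⟩
    weight F w (relabel g M′)     ≈⟨ ≈-sym (weight-relabel f g fg gf w M′) ⟩
    weight F (λ x → w (f x)) M′   ∎
    where
    relabelled = maximal-relabel f g fg gf f-hom g-hom

  weight-++ : ∀ {a b} (w : Fin (a ℕ.+ b) → Carrier) (u : Subset a) (v : Subset b) →
    weight F w (u ++ v) ≈ weight F (λ i → w (i ↑ˡ b)) u + weight F (λ j → w (a ↑ʳ j)) v
  weight-++ w []      v = ≈-sym (+-identityˡ _)
  weight-++ {suc a} {b} w (x ∷ u) v = begin
    x̂ + weight F (λ i → w (suc i)) (u ++ v)  ≈⟨ +-congˡ (weight-++ (λ i → w (suc i)) u v) ⟩
    x̂ + (U + V)                              ≈⟨ ≈-sym (+-assoc x̂ U V) ⟩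
    (x̂ + U) + V                              ∎
    where
    x̂ = contribution w (x ∷ u ++ v) zero
    U = weight F (λ i → w (suc (i ↑ˡ b))) u
    V = weight F (λ j → w (suc (a ↑ʳ j))) v

  window-exchange : ∀ {a k b} (w : Fin (a ℕ.+ (k ℕ.+ b)) → Carrier) (u : Subset a) (X Y : Subset k)
    (v : Subset b) →
    weight F w (u ++ (X ++ v)) ≈ weight F w (u ++ (Y ++ v)) →
    weight F (λ i → w (a ↑ʳ (i ↑ˡ b))) X ≈ weight F (λ i → w (a ↑ʳ (i ↑ˡ b))) Y
  window-exchange {a} {k} {b} w u X Y v same =
    ∙-cancelʳ (weight F outer v) _ _ (∙-cancelˡ (weight F (λ i → w (i ↑ˡ (k ℕ.+ b))) u) _ _ (begin
      U + (weight F inner X + weight F outer v) ≈⟨ +-congˡ (≈-sym (weight-++ (λ j → w (a ↑ʳ j)) X v)) ⟩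
      U + weight F (λ j → w (a ↑ʳ j)) (X ++ v)  ≈⟨ ≈-sym (weight-++ w u (X ++ v)) ⟩
      weight F w (u ++ (X ++ v))                ≈⟨ same ⟩
      weight F w (u ++ (Y ++ v))                ≈⟨ weight-++ w u (Y ++ v) ⟩
      U + weight F (λ j → w (a ↑ʳ j)) (Y ++ v)  ≈⟨ +-congˡ (weight-++ (λ j → w (a ↑ʳ j)) Y v) ⟩
      U + (weight F inner Y + weight F outer v) ∎))
    where
    U = weight F (λ i → w (i ↑ˡ (k ℕ.+ b))) u
    inner : Fin k → Carrier
    inner i = w (a ↑ʳ (i ↑ˡ b))
    outer : Fin b → Carrier
    outer j = w (a ↑ʳ (k ↑ʳ j))

  exchange-pair : ∀ {a b} {E : Graph (a ℕ.+ (2 ℕ.+ b))} w (u : Subset a) (v : Subset b) →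
    WellCovered F E w →
    MaximalIndependent E (u ++ (true ∷ false ∷ v)) → MaximalIndependent E (u ++ (false ∷ true ∷ v)) →
    w (a ↑ʳ zero) ≈ w (a ↑ʳ suc zero)
  exchange-pair {a} w u v w-wc m m′ = begin
    x              ≈⟨ ≈-sym (≈-trans (+-congˡ (+-identityˡ 0#)) (+-identityʳ x)) ⟩
    x + (0# + 0#)  ≈⟨ window-exchange w u (true ∷ false ∷ []) (false ∷ true ∷ []) v (w-wc _ _ m m′) ⟩
    0# + (y + 0#)  ≈⟨ ≈-trans (+-identityˡ _) (+-identityʳ _) ⟩
    y              ∎
    where
    x = w (a ↑ʳ zero)
    y = w (a ↑ʳ suc zero)

  exchange-triple : ∀ {a b} {E : Graph (a ℕ.+ (3 ℕ.+ b))} w (u : Subset a) (v : Subset b) →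
    WellCovered F E w → MaximalIndependent E (u ++ (true ∷ false ∷ true ∷ v)) →
    MaximalIndependent E (u ++ (false ∷ true ∷ false ∷ v)) →
    w (a ↑ʳ zero) + w (a ↑ʳ suc (suc zero)) ≈ w (a ↑ʳ suc zero)
  exchange-triple {a} w u v w-wc m m′ = begin
    x + z               ≈⟨ ≈-sym (+-congˡ (≈-trans (+-identityˡ _) (+-identityʳ _))) ⟩
    x + (0# + (z + 0#))  ≈⟨ window-exchange w u (true ∷ false ∷ true ∷ []) (false ∷ true ∷ false ∷ []) v
                                            (w-wc _ _ m m′) ⟩
    0# + (y + (0# + 0#)) ≈⟨ ≈-trans (+-identityˡ _) (≈-trans (+-congˡ (+-identityʳ _)) (+-identityʳ _)) ⟩
    y                   ∎
    where
    x = w (a ↑ʳ zero)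
    y = w (a ↑ʳ suc zero)
    z = w (a ↑ʳ suc (suc zero))

  -- The indicator b of a leaf i and its neighbour j weighs 1 on every maximal independent set,
  -- which contains exactly one of them; so b is well-covered.
  leaf-indicator-wellCovered : ∀ {n} {E : Graph n} {i j} (b : Fin n → Carrier) → Irreflexive E →
    E i j → (∀ y → E i y ⊎ E y i → y ≡ j) →
    b i ≈ 1# → b j ≈ 1# → (∀ x → x ≢ i → x ≢ j → b x ≈ 0#) → WellCovered F E b
  leaf-indicator-wellCovered {E = E} {i} {j} b irr i~j only bi≈1 bj≈1 off M M′ m m′ =
    ≈-trans (weighs-one m) (≈-sym (weighs-one m′))
    where
    i≢j : i ≢ j
    i≢j refl = irr i i~j
    exactly-one : ∀ {M} → (i ∈ M × j ∉ M) ⊎ (i ∉ M × j ∈ M) →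
      contribution b M i + contribution b M j ≈ 1#
    exactly-one (inj₁ (i∈ , j∉)) rewrite ∈⇒lookup i∈ | ∉⇒lookup j∉ = ≈-trans (+-identityʳ _) bi≈1
    exactly-one (inj₂ (i∉ , j∈)) rewrite ∉⇒lookup i∉ | ∈⇒lookup j∈ = ≈-trans (+-identityˡ _) bj≈1
    weighs-one : ∀ {M} → MaximalIndependent E M → weight F b M ≈ 1#
    weighs-one {M} m = begin
      weight F b M                               ≈⟨ sumF-pair (contribution b M) i j i≢j
                                                      (λ x x≢i x≢j → contribution-vanishes b M x (off x x≢i x≢j)) ⟩
      contribution b M i + contribution b M j    ≈⟨ exactly-one (leaf-exactly-one irr i~j only m) ⟩
      1#                                         ∎

  ⟦_⟧ : Sign → Carrier
  ⟦ plus ⟧  = 1#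
  ⟦ nil ⟧   = 0#
  ⟦ minus ⟧ = - 1#

  signed : ∀ {n} → Vec Sign n → Fin n → Carrier
  signed s x = ⟦ lookup s x ⟧

  ι : ℕ → Carrier
  ι k = k · 1#

  signed-weight : ∀ {n} (s : Vec Sign n) S → weight F (signed s) S ≈ ι (positives s S) - ι (negatives s S)
  signed-weight []          []          = ≈-sym (-‿inverseʳ 0#)
  signed-weight (plus ∷ s)  (true ∷ S)  = ≈-trans (+-congˡ (signed-weight s S)) (≈-sym (+-assoc _ _ _))
  signed-weight (minus ∷ s) (true ∷ S)  = begin
    - 1# + weight F (signed s) S                      ≈⟨ +-congˡ (signed-weight s S) ⟩
    - 1# + (ι (positives s S) - ι (negatives s S))    ≈⟨ x∙yz≈y∙xz _ _ _ ⟩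
    ι (positives s S) + (- 1# - ι (negatives s S))    ≈⟨ +-congˡ (⁻¹-∙-comm 1# _) ⟩
    ι (positives s S) - ι (suc (negatives s S))       ∎
  signed-weight (nil ∷ s)   (true ∷ S)  = ≈-trans (+-identityˡ _) (signed-weight s S)
  signed-weight (plus ∷ s)  (false ∷ S) = ≈-trans (+-identityˡ _) (signed-weight s S)
  signed-weight (nil ∷ s)   (false ∷ S) = ≈-trans (+-identityˡ _) (signed-weight s S)
  signed-weight (minus ∷ s) (false ∷ S) = ≈-trans (+-identityˡ _) (signed-weight s S)

  neg-cancel : ∀ x y → - x + (x + y) ≈ y
  neg-cancel x y = ≈-trans (≈-sym (+-assoc _ _ _)) (≈-trans (+-congʳ (-‿inverseˡ x)) (+-identityˡ y))

  difference : ∀ {a b c d} → a + d ≈ c + b → a - b ≈ c - d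
  difference {a} {b} {c} {d} e = ∙-cancelʳ (b + d) _ _ (begin
    (a - b) + (b + d)  ≈⟨ +-assoc _ _ _ ⟩
    a + (- b + (b + d)) ≈⟨ +-congˡ (neg-cancel b d) ⟩
    a + d              ≈⟨ e ⟩
    c + b              ≈⟨ +-congˡ (≈-sym (neg-cancel d b)) ⟩
    c + (- d + (d + b)) ≈⟨ ≈-sym (+-assoc _ _ _) ⟩
    (c - d) + (d + b)  ≈⟨ +-congˡ (+-comm d b) ⟩
    (c - d) + (b + d)  ∎)

  -- A signed weighting is well-covered when every maximal independent set M satisfies
  -- positives M + q = p + negatives M: its weight is then always p - q.
  signed-wellCovered : ∀ {n} {E : Graph n} (s : Vec Sign n) p q →
    (∀ M → MaximalIndependent E M → Balanced s p q M) → WellCovered F E (signed s)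
  signed-wellCovered {E = E} s p q balanced M M′ m m′ = ≈-trans (constant m) (≈-sym (constant m′))
    where
    constant : ∀ {M} → MaximalIndependent E M → weight F (signed s) M ≈ ι p - ι q
    constant {M} m = ≈-trans (signed-weight s M) (difference (begin
      ι (positives s M) + ι q           ≈⟨ ≈-sym (×-homo-+ 1# (positives s M) q) ⟩
      ι (positives s M ℕ.+ q)           ≡⟨ cong ι (balanced M m) ⟩
      ι (p ℕ.+ negatives s M)           ≈⟨ ×-homo-+ 1# p (negatives s M) ⟩
      ι p + ι (negatives s M)           ∎))

  indicator-yes : ∀ {p} {P : Set p} (P? : Dec P) → P → (if does P? then 1# else 0#) ≈ 1#
  indicator-yes P? p = ≈-reflexive (cong (λ b → if b then 1# else 0#) (dec-true P? p))

  indicator-no : ∀ {p} {P : Set p} (P? : Dec P) → ¬ P → (if does P? then 1# else 0#) ≈ 0#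
  indicator-no P? ¬p = ≈-reflexive (cong (λ b → if b then 1# else 0#) (dec-false P? ¬p))

  path-pair : ∀ {n a b} → Margin a → Margin b → a ℕ.+ (2 ℕ.+ b) ≡ n → ∀ (w : Fin n → Carrier) →
    WellCovered F (PathAdj n) w → ∀ x y → toℕ x ≡ a → toℕ y ≡ suc a → w x ≈ w y
  path-pair {a = a} ma mb refl w w-wc x y x≡a y≡a+1 = begin
    w x                ≈⟨ ≈-toℕ w (trans x≡a (sym (toℕ-shifted a zero))) ⟩
    w (a ↑ʳ zero)      ≈⟨ exchange-pair w (opening ma) (closing mb) w-wc mis mis′ ⟩
    w (a ↑ʳ suc zero)  ≈⟨ ≈-toℕ w (trans (toℕ-shifted a (suc zero)) (sym y≡a+1)) ⟩
    w y                ∎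
    where
    mis  = framed-maximal ma (true ∷ false ∷ []) mb (closing-accepted false mb)
    mis′ = framed-maximal ma (false ∷ true ∷ []) mb (closing-accepted true mb)

  path-triple : ∀ {n a b} → Margin a → Margin b → a ℕ.+ (3 ℕ.+ b) ≡ n → ∀ (w : Fin n → Carrier) →
    WellCovered F (PathAdj n) w → ∀ x y z → toℕ x ≡ a → toℕ y ≡ suc a → toℕ z ≡ suc (suc a) →
    w x + w z ≈ w y
  path-triple {a = a} ma mb refl w w-wc x y z x≡a y≡a+1 z≡a+2 = begin
    w x + w z                                ≈⟨ +-cong (renumber zero x≡a) (renumber (suc (suc zero)) z≡a+2) ⟩
    w (a ↑ʳ zero) + w (a ↑ʳ suc (suc zero))  ≈⟨ exchange-triple w (opening ma) (closing mb) w-wc mis mis′ ⟩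
    w (a ↑ʳ suc zero)                        ≈⟨ ≈-sym (renumber (suc zero) y≡a+1) ⟩
    w y                                      ∎
    where
    renumber : ∀ {v} i → toℕ v ≡ toℕ i ℕ.+ a → w v ≈ w (a ↑ʳ i)
    renumber i e = ≈-toℕ w (trans e (sym (toℕ-shifted a i)))
    mis  = framed-maximal ma (true ∷ false ∷ true ∷ []) mb (closing-accepted true mb)
    mis′ = framed-maximal ma (false ∷ true ∷ false ∷ []) mb (closing-accepted false mb)

  path-first-pair : ∀ {n} → 4 ≤ n → ∀ w → WellCovered F (PathAdj n) w →
    ∀ i j → toℕ i ≡ 0 → toℕ j ≡ 1 → w i ≈ w j
  path-first-pair (s≤s (s≤s (s≤s (s≤s {n = k} _)))) = path-pair none (wide k) refl

  path-last-pair : ∀ {n} → 4 ≤ n → ∀ w → WellCovered F (PathAdj n) w →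
    ∀ i j → toℕ i ≡ n ∸ 2 → toℕ j ≡ n ∸ 1 → w i ≈ w j
  path-last-pair (s≤s (s≤s (s≤s (s≤s {n = k} _)))) = path-pair (wide k) none (ℕₚ.+-comm (2 ℕ.+ k) 2)

  -- w vanishes at v₃, …, v_{n-2}, by induction on the distance d of the vertex from v_{n-2}:
  -- v_{n-2} is handled by the triple v_{n-2} v_{n-1} v_n, the others by the pair with their right
  -- neighbour
  interior-zero-by-distance : ∀ d {n} (w : Fin n → Carrier) → WellCovered F (PathAdj n) w →
    ∀ x → 2 ≤ toℕ x → toℕ x ℕ.+ (3 ℕ.+ d) ≡ n → w x ≈ 0#
  interior-zero-by-distance zero w w-wc x 2≤x e with ℕₚ.m≤n⇒∃[o]m+o≡n 2≤x
  ... | k , 2+k≡x = identityˡ-unique (w x) (w z) (≈-trans x+z≈y y≈z)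
    where
    e-x = trans (cong (ℕ._+ 3) 2+k≡x) e
    e-y = trans (sym (ℕₚ.+-suc (toℕ x) 2)) e
    e-z = trans (cong suc (sym (ℕₚ.+-suc (toℕ x) 1))) e-y
    y = vertexAt (suc (toℕ x)) 1 e-y
    z = vertexAt (suc (suc (toℕ x))) 0 e-z
    y≡ : toℕ y ≡ suc (2 ℕ.+ k)
    y≡ = trans (toℕ-vertexAt _ 1 e-y) (cong suc (sym 2+k≡x))
    z≡ : toℕ z ≡ suc (suc (2 ℕ.+ k))
    z≡ = trans (toℕ-vertexAt _ 0 e-z) (cong (λ t → suc (suc t)) (sym 2+k≡x))
    x+z≈y : w x + w z ≈ w y
    x+z≈y = path-triple (wide k) none e-x w w-wc x y z (sym 2+k≡x) y≡ z≡
    y≈z : w y ≈ w z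
    y≈z = path-pair (wide (suc k)) none (trans (cong (λ t → suc (suc t)) (sym (ℕₚ.+-suc k 2))) e-x)
            w w-wc y z y≡ z≡
  interior-zero-by-distance (suc d) w w-wc x 2≤x e with ℕₚ.m≤n⇒∃[o]m+o≡n 2≤x
  ... | k , 2+k≡x = ≈-trans x≈y (interior-zero-by-distance d w w-wc y 2≤y e-y′)
    where
    e-y : suc (toℕ x) ℕ.+ (3 ℕ.+ d) ≡ _
    e-y = trans (sym (ℕₚ.+-suc (toℕ x) (3 ℕ.+ d))) e
    y = vertexAt (suc (toℕ x)) (2 ℕ.+ d) e-y
    y≡ : toℕ y ≡ suc (toℕ x)
    y≡ = toℕ-vertexAt _ (2 ℕ.+ d) e-y
    e-y′ : toℕ y ℕ.+ (3 ℕ.+ d) ≡ _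
    e-y′ = trans (cong (ℕ._+ (3 ℕ.+ d)) y≡) e-y
    2≤y : 2 ≤ toℕ y
    2≤y = ℕₚ.≤-trans (ℕₚ.m≤n⇒m≤1+n 2≤x) (ℕₚ.≤-reflexive (sym y≡))
    x≈y : w x ≈ w y
    x≈y = path-pair (wide k) (wide d) (trans (cong (ℕ._+ (4 ℕ.+ d)) 2+k≡x) e) w w-wc x y (sym 2+k≡x)
            (trans y≡ (cong suc (sym 2+k≡x)))

  path-interior-zero : ∀ {n} (w : Fin n → Carrier) → WellCovered F (PathAdj n) w →
    ∀ x → 2 ≤ toℕ x → toℕ x ℕ.+ 3 ≤ n → w x ≈ 0#
  path-interior-zero w w-wc x 2≤x x+3≤n with ℕₚ.m≤n⇒∃[o]m+o≡n x+3≤n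
  ... | d , e = interior-zero-by-distance d w w-wc x 2≤x (trans (sym (ℕₚ.+-assoc (toℕ x) 3 d)) e)

  path-relations : ∀ n → 5 ≤ n → (w : Fin n → Carrier) → WellCovered F (PathAdj n) w →
      (∀ (i j : Fin n) → toℕ i ≡ 0 → toℕ j ≡ 1 → w i ≈ w j)
    × (∀ (i : Fin n) → 2 ≤ toℕ i → toℕ i ℕ.+ 3 ≤ n → w i ≈ 0#)
    × (∀ (i j : Fin n) → toℕ i ≡ n ∸ 2 → toℕ j ≡ n ∸ 1 → w i ≈ w j)
  path-relations n 5≤n w w-wc =
    path-first-pair 4≤n w w-wc , path-interior-zero w w-wc , path-last-pair 4≤n w w-wc
    where
    4≤n = ℕₚ.≤-trans (ℕₚ.n≤1+n 4) 5≤n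

  first-pair : ∀ {n} → Fin n → Carrier
  first-pair x = if toℕ x ℕ.<ᵇ 2 then 1# else 0#

  last-pair : ∀ {m} → Fin (2 ℕ.+ m) → Carrier
  last-pair {m} x = if does (m ℕₚ.≤? toℕ x) then 1# else 0#

  -- the indicator of the first pair is well-covered: v₁ is a leaf with neighbour v₂
  first-pair-wellCovered : ∀ {m} → WellCovered F (PathAdj (2 ℕ.+ m)) first-pair
  first-pair-wellCovered = leaf-indicator-wellCovered first-pair path-irreflexive (inj₁ refl) path-first-leaf
                             ≈-refl ≈-refl off
    where
    off : ∀ x → x ≢ zero → x ≢ suc zero → first-pair x ≈ 0#
    off zero          x≢0 _   = ⊥-elim (x≢0 refl)
    off (suc zero)    _   x≢1 = ⊥-elim (x≢1 refl)
    off (suc (suc x)) _   _   = ≈-refl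

  last-pair-at-last : ∀ {m} → last-pair {m} (fromℕ (suc m)) ≈ 1#
  last-pair-at-last {m} =
    indicator-yes (m ℕₚ.≤? _) (ℕₚ.≤-trans (ℕₚ.n≤1+n m) (ℕₚ.≤-reflexive (sym (toℕ-fromℕ (suc m)))))

  -- the indicator of the last pair is well-covered: v_n is a leaf with neighbour v_{n-1}
  last-pair-wellCovered : ∀ {m} → WellCovered F (PathAdj (2 ℕ.+ m)) last-pair
  last-pair-wellCovered {m} =
    leaf-indicator-wellCovered last-pair path-irreflexive (inj₂ (cong suc (toℕ-inject₁ (fromℕ m))))
      path-last-leaf (last-pair-at-last {m}) (indicator-yes (m ℕₚ.≤? _) m≤penult)
      (λ x x≢last x≢penult → indicator-no (m ℕₚ.≤? toℕ x) (near-end x x≢last x≢penult))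
    where
    toℕ-penult : toℕ (inject₁ (fromℕ m)) ≡ m
    toℕ-penult = trans (toℕ-inject₁ (fromℕ m)) (toℕ-fromℕ m)
    m≤penult : m ≤ toℕ (inject₁ (fromℕ m))
    m≤penult = ℕₚ.≤-reflexive (sym toℕ-penult)
    near-end : ∀ x → x ≢ fromℕ (suc m) → x ≢ inject₁ (fromℕ m) → ¬ m ≤ toℕ x
    near-end x x≢last x≢penult m≤x = ℕₚ.<⇒≱ (toℕ<n x)
      (ℕₚ.≤∧≢⇒< (ℕₚ.≤∧≢⇒< m≤x (λ e → x≢penult (toℕ-injective (trans (sym e) (sym toℕ-penult)))))
                (λ e → x≢last (toℕ-injective (trans (sym e) (sym (toℕ-fromℕ (suc m)))))))

  path-determined : ∀ m w → WellCovered F (PathAdj (3 ℕ.+ m)) w →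
    w zero ≈ 0# → w (fromℕ (2 ℕ.+ m)) ≈ 0# → ∀ x → w x ≈ 0#
  path-determined zero w w-wc w₁≈0 w₃≈0 zero             = w₁≈0
  path-determined zero w w-wc w₁≈0 w₃≈0 (suc zero)       = begin
    w (suc zero)                ≈⟨ ≈-sym (path-triple none none refl w w-wc zero _ (suc (suc zero)) refl refl refl) ⟩
    w zero + w (suc (suc zero)) ≈⟨ +-cong w₁≈0 w₃≈0 ⟩
    0# + 0#                     ≈⟨ +-identityˡ 0# ⟩
    0#                          ∎
  path-determined zero w w-wc w₁≈0 w₃≈0 (suc (suc zero)) = w₃≈0
  path-determined (suc k) w w-wc first≈0 last≈0 x = by-position (path-vertex-cases x)
    where
    4≤n : 4 ≤ 4 ℕ.+ k
    4≤n = s≤s (s≤s (s≤s (s≤s z≤n)))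
    by-position : _ → w x ≈ 0#
    by-position (inj₁ x≡0) = ≈-trans (≈-toℕ w x≡0) first≈0
    by-position (inj₂ (inj₁ x≡1)) = ≈-trans (≈-sym (path-first-pair 4≤n w w-wc zero x refl x≡1)) first≈0
    by-position (inj₂ (inj₂ (inj₁ (2≤x , x+3≤n)))) = path-interior-zero w w-wc x 2≤x x+3≤n
    by-position (inj₂ (inj₂ (inj₂ (inj₁ x≡n-2)))) =
      ≈-trans (path-last-pair 4≤n w w-wc x (fromℕ (3 ℕ.+ k)) x≡n-2 (toℕ-fromℕ _)) last≈0
    by-position (inj₂ (inj₂ (inj₂ (inj₂ x≡n-1)))) =
      ≈-trans (≈-toℕ w (trans x≡n-1 (sym (toℕ-fromℕ _)))) last≈0

  path-two-dimension : wcdim≡ F (PathAdj 2) 1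
  path-two-dimension = dimension-by-coordinates (PathAdj 2) (λ _ → first-pair) (λ _ → zero)
    (λ _ → first-pair-wellCovered) (λ { zero zero → ≈-refl ; (suc ()) _ ; _ (suc ()) }) determined
    where
    determined : ∀ w → WellCovered F (PathAdj 2) w → (∀ j → w zero ≈ 0#) → ∀ x → w x ≈ 0#
    determined w w-wc w₁≈0 zero       = w₁≈0 zero
    determined w w-wc w₁≈0 (suc zero) =
      ≈-trans (≈-sym (path-pair none none refl w w-wc zero (suc zero) refl refl)) (w₁≈0 zero)

  path-dimension : ∀ n → 3 ≤ n → wcdim≡ F (PathAdj n) 2
  path-dimension .(3 ℕ.+ m) (s≤s (s≤s (s≤s {n = m} _))) =
    dimension-by-coordinates (PathAdj (3 ℕ.+ m)) basis end basis-wc basis-δ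
      (λ w w-wc ends≈0 → path-determined m w w-wc (ends≈0 zero) (ends≈0 (suc zero)))
    where
    basis : Fin 2 → Fin (3 ℕ.+ m) → Carrier
    basis zero       = first-pair
    basis (suc zero) = last-pair
    end : Fin 2 → Fin (3 ℕ.+ m)
    end zero       = zero
    end (suc zero) = fromℕ (2 ℕ.+ m)
    basis-wc : ∀ i → WellCovered F (PathAdj (3 ℕ.+ m)) (basis i)
    basis-wc zero       = first-pair-wellCovered
    basis-wc (suc zero) = last-pair-wellCovered
    basis-δ : ∀ i j → basis i (end j) ≈ δ i j
    basis-δ zero       zero       = ≈-refl
    basis-δ zero       (suc zero) = ≈-refl
    basis-δ (suc zero) zero       = ≈-refl
    basis-δ (suc zero) (suc zero) = last-pair-at-last {suc m}

  rotate : ∀ {m} (w : Fin (suc m) → Carrier) → WellCovered F (CycleAdj (suc m)) w →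
    WellCovered F (CycleAdj (suc m)) (λ x → w (next x))
  rotate = wellCovered-automorphism next prev next-prev prev-next next-automorphism prev-automorphism

  cycle-constant : ∀ {m} → (∀ w → WellCovered F (CycleAdj (suc m)) w → w zero ≈ w (next zero)) →
    ∀ w → WellCovered F (CycleAdj (suc m)) w → ∀ x → w x ≈ w zero
  cycle-constant {m} pair w w-wc x = by-distance (toℕ x) x refl w w-wc
    where
    by-distance : ∀ k (x : Fin (suc m)) → toℕ x ≡ k →
      ∀ w → WellCovered F (CycleAdj (suc m)) w → w x ≈ w zero
    by-distance zero    zero    _  w _    = ≈-refl
    by-distance zero    (suc x) ()
    by-distance (suc k) zero    ()
    by-distance (suc k) (suc x) e  w w-wc = begin
      w (suc x)             ≡⟨ cong w (sym (next-prev (suc x))) ⟩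
      w (next (inject₁ x))  ≈⟨ by-distance k (inject₁ x) (trans (toℕ-inject₁ x) (suc-injective e))
                                             (λ y → w (next y)) (rotate w w-wc) ⟩
      w (next zero)         ≈⟨ ≈-sym (pair w w-wc) ⟩
      w zero                ∎

  large-cycle-pair : ∀ k w → WellCovered F (CycleAdj (8 ℕ.+ k)) w → w zero ≈ w (suc zero)
  large-cycle-pair k w w-wc = exchange-pair w [] (false ∷ alternating-open (suc k)) w-wc
    (path⇒cycle-maximal _ (alternating-open-last (suc k))
                          (accepts-maximal _ (alternating-open-accepted (suc k) true)))
    (path⇒cycle-maximal _ (alternating-open-last (suc k))
                          (accepts-maximal _ (alternating-open-accepted (suc k) false)))

  large-cycle-triple : ∀ k w → WellCovered F (CycleAdj (8 ℕ.+ k)) w →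
    w zero + w (suc (suc zero)) ≈ w (suc zero)
  large-cycle-triple k w w-wc = exchange-triple w [] (false ∷ alternating-open k) w-wc
    (path⇒cycle-maximal _ (alternating-open-last k) (accepts-maximal _ (alternating-open-accepted k false)))
    (path⇒cycle-maximal _ (alternating-open-last k) (accepts-maximal _ (alternating-open-accepted k true)))

  -- wcdim(C_n) = 0 for n ≥ 8: a well-covered weighting is constant, and w₁ + w₃ = w₂ forces it to vanish
  large-cycle-dimension : ∀ n → 8 ≤ n → wcdim≡ F (CycleAdj n) 0
  large-cycle-dimension .(8 ℕ.+ k) (s≤s (s≤s (s≤s (s≤s (s≤s (s≤s (s≤s (s≤s {n = k} _)))))))) =
    dimension-by-coordinates (CycleAdj (8 ℕ.+ k)) (λ ()) (λ ()) (λ ()) (λ ()) vanishes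
    where
    vanishes : ∀ w → WellCovered F (CycleAdj (8 ℕ.+ k)) w → _ → ∀ x → w x ≈ 0#
    vanishes w w-wc _ x = ≈-trans (constant x) (identityʳ-unique (w zero) (w zero) (begin
      w zero + w zero                ≈⟨ +-congˡ (≈-sym (constant (suc (suc zero)))) ⟩
      w zero + w (suc (suc zero))    ≈⟨ large-cycle-triple k w w-wc ⟩
      w (suc zero)                   ≈⟨ constant (suc zero) ⟩
      w zero                         ∎))
      where
      constant = cycle-constant (large-cycle-pair k) w w-wc

  small-cycle-pair : ∀ {b} (v : Subset b) → True (cycle-maximal? b (true ∷ false ∷ v)) →
    True (cycle-maximal? b (false ∷ true ∷ v)) →
    ∀ w → WellCovered F (CycleAdj (2 ℕ.+ b)) w → w zero ≈ w (next zero)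
  small-cycle-pair v m m′ w w-wc = exchange-pair w [] v w-wc (toWitness m) (toWitness m′)

  signed-cycle-wellCovered : ∀ m (s : Vec Sign (2 ℕ.+ m)) p q → CheckedOnMaximal m (balanced? s p q) →
    WellCovered F (CycleAdj (2 ℕ.+ m)) (signed s)
  signed-cycle-wellCovered m s p q checked = signed-wellCovered s p q (cycle-search m (balanced? s p q) checked)

  constant-cycle-dimension : ∀ m p → CheckedOnMaximal m (balanced? (replicate (2 ℕ.+ m) plus) p 0) →
    (∀ w → WellCovered F (CycleAdj (2 ℕ.+ m)) w → w zero ≈ w (next zero)) → wcdim≡ F (CycleAdj (2 ℕ.+ m)) 1
  constant-cycle-dimension m p same-size pair =
    dimension-by-coordinates (CycleAdj (2 ℕ.+ m)) (λ _ → signed (replicate _ plus)) (λ _ → zero)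
      (λ _ → signed-cycle-wellCovered m (replicate _ plus) p 0 same-size)
      (λ { zero zero → ≈-refl ; (suc ()) _ ; _ (suc ()) })
      (λ w w-wc first≈0 x → ≈-trans (cycle-constant pair w w-wc x) (first≈0 zero))

  -- the odd cycles C₃, C₅, C₇: every maximal independent set has 1, 2, resp. 3 vertices, and
  -- exchanging the first vertex of one for its right neighbour gives another
  cycle-three-dimension : wcdim≡ F (CycleAdj 3) 1
  cycle-three-dimension = constant-cycle-dimension 1 1 _ (small-cycle-pair (false ∷ []) _ _)

  cycle-five-dimension : wcdim≡ F (CycleAdj 5) 1
  cycle-five-dimension = constant-cycle-dimension 3 2 _ (small-cycle-pair (false ∷ true ∷ false ∷ []) _ _)

  cycle-seven-dimension : wcdim≡ F (CycleAdj 7) 1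
  cycle-seven-dimension =
    constant-cycle-dimension 5 3 _ (small-cycle-pair (false ∷ true ∷ false ∷ true ∷ false ∷ []) _ _)

  -- wcdim(C₆) = 2.  The exchange {v₁, v₃, v₅} ↔ {v₂, v₅} gives w₁ + w₃ = w₂, and by rotation
  -- w_k + w_{k+2} = w_{k+1} for all k; so w is determined by w₁ and w₂.
  cycle-six-dimension : wcdim≡ F (CycleAdj 6) 2
  cycle-six-dimension = dimension-by-coordinates (CycleAdj 6) basis coordinate basis-wc basis-δ determined
    where
    signs : Fin 2 → Vec Sign 6
    signs zero       = plus ∷ nil ∷ minus ∷ minus ∷ nil ∷ plus ∷ []
    signs (suc zero) = nil ∷ plus ∷ plus ∷ nil ∷ minus ∷ minus ∷ []
    basis : Fin 2 → Fin 6 → Carrier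
    basis i = signed (signs i)
    coordinate : Fin 2 → Fin 6
    coordinate zero       = zero
    coordinate (suc zero) = suc zero
    basis-wc : ∀ i → WellCovered F (CycleAdj 6) (basis i)
    basis-wc zero       = signed-cycle-wellCovered 4 (signs zero) 0 0 _
    basis-wc (suc zero) = signed-cycle-wellCovered 4 (signs (suc zero)) 0 0 _
    basis-δ : ∀ i j → basis i (coordinate j) ≈ δ i j
    basis-δ zero       zero       = ≈-refl
    basis-δ zero       (suc zero) = ≈-refl
    basis-δ (suc zero) zero       = ≈-refl
    basis-δ (suc zero) (suc zero) = ≈-refl
    triple : ∀ w → WellCovered F (CycleAdj 6) w → w zero + w (suc (suc zero)) ≈ w (suc zero)
    triple w w-wc = exchange-triple w [] (false ∷ true ∷ false ∷ []) w-wc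
                      (toWitness {a? = cycle-maximal? 4 _} _) (toWitness {a? = cycle-maximal? 4 _} _)
    turn : (Fin 6 → Carrier) → Fin 6 → Carrier
    turn w x = w (next x)
    determined : ∀ w → WellCovered F (CycleAdj 6) w → (∀ j → w (coordinate j) ≈ 0#) → ∀ x → w x ≈ 0#
    determined w w-wc coordinates≈0 = vanish
      where
      w₁≈0 = coordinates≈0 zero
      w₂≈0 = coordinates≈0 (suc zero)
      w₃≈0 = vanishes-by w₁≈0 w₂≈0 (triple w w-wc)
      -- the relation w_{k+1} + w_{k+3} = w_{k+2} for k = 1, 2, 3 comes from rotating w k times
      w′ = turn w
      w″ = turn w′
      w‴ = turn w″
      w′-wc  = rotate w w-wc
      w″-wc  = rotate w′ w′-wc
      w‴-wc  = rotate w″ w″-wc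
      w₄≈0 = vanishes-by w₂≈0 w₃≈0 (triple w′ w′-wc)
      w₅≈0 = vanishes-by w₃≈0 w₄≈0 (triple w″ w″-wc)
      w₆≈0 = vanishes-by w₄≈0 w₅≈0 (triple w‴ w‴-wc)
      vanish : ∀ x → w x ≈ 0#
      vanish zero = w₁≈0
      vanish (suc zero) = w₂≈0
      vanish (suc (suc zero)) = w₃≈0
      vanish (suc (suc (suc zero))) = w₄≈0
      vanish (suc (suc (suc (suc zero)))) = w₅≈0
      vanish (suc (suc (suc (suc (suc zero))))) = w₆≈0

  cycle-four-relation : ∀ w → WellCovered F (CycleAdj 4) w →
    w zero + w (suc (suc zero)) ≈ w (suc zero) + w (suc (suc (suc zero)))
  cycle-four-relation w w-wc = begin
    w zero + w (suc (suc zero))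
      ≈⟨ +-congˡ (≈-sym (≈-trans (+-identityˡ _) (≈-trans (+-congˡ (+-identityˡ 0#)) (+-identityʳ _)))) ⟩
    weight F w (true ∷ false ∷ true ∷ false ∷ [])
      ≈⟨ w-wc (true ∷ false ∷ true ∷ false ∷ []) (false ∷ true ∷ false ∷ true ∷ [])
              (toWitness {a? = cycle-maximal? 2 _} _) (toWitness {a? = cycle-maximal? 2 _} _) ⟩
    weight F w (false ∷ true ∷ false ∷ true ∷ [])
      ≈⟨ ≈-trans (+-identityˡ _) (+-congˡ (≈-trans (+-identityˡ _) (+-identityʳ _))) ⟩
    w (suc zero) + w (suc (suc (suc zero)))
      ∎

  -- wcdim(C₄) = 3: by the exchange {v₁, v₃} ↔ {v₂, v₄}, w is determined by w₁, w₂, w₃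
  cycle-four-dimension : wcdim≡ F (CycleAdj 4) 3
  cycle-four-dimension = dimension-by-coordinates (CycleAdj 4) basis coordinate basis-wc basis-δ determined
    where
    signs : Fin 3 → Vec Sign 4
    signs zero             = plus ∷ nil ∷ nil ∷ plus ∷ []
    signs (suc zero)       = nil ∷ plus ∷ nil ∷ minus ∷ []
    signs (suc (suc zero)) = nil ∷ nil ∷ plus ∷ plus ∷ []
    basis : Fin 3 → Fin 4 → Carrier
    basis i = signed (signs i)
    coordinate : Fin 3 → Fin 4
    coordinate zero             = zero
    coordinate (suc zero)       = suc zero
    coordinate (suc (suc zero)) = suc (suc zero)
    basis-wc : ∀ i → WellCovered F (CycleAdj 4) (basis i)
    basis-wc zero             = signed-cycle-wellCovered 2 (signs zero) 1 0 _
    basis-wc (suc zero)       = signed-cycle-wellCovered 2 (signs (suc zero)) 0 0 _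
    basis-wc (suc (suc zero)) = signed-cycle-wellCovered 2 (signs (suc (suc zero))) 1 0 _
    basis-δ : ∀ i j → basis i (coordinate j) ≈ δ i j
    basis-δ zero             zero             = ≈-refl
    basis-δ zero             (suc zero)       = ≈-refl
    basis-δ zero             (suc (suc zero)) = ≈-refl
    basis-δ (suc zero)       zero             = ≈-refl
    basis-δ (suc zero)       (suc zero)       = ≈-refl
    basis-δ (suc zero)       (suc (suc zero)) = ≈-refl
    basis-δ (suc (suc zero)) zero             = ≈-refl
    basis-δ (suc (suc zero)) (suc zero)       = ≈-refl
    basis-δ (suc (suc zero)) (suc (suc zero)) = ≈-refl
    determined : ∀ w → WellCovered F (CycleAdj 4) w → (∀ j → w (coordinate j) ≈ 0#) → ∀ x → w x ≈ 0#
    determined w w-wc coordinates≈0 zero             = coordinates≈0 zero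
    determined w w-wc coordinates≈0 (suc zero)       = coordinates≈0 (suc zero)
    determined w w-wc coordinates≈0 (suc (suc zero)) = coordinates≈0 (suc (suc zero))
    determined w w-wc coordinates≈0 (suc (suc (suc zero))) =
      vanishes-by (coordinates≈0 (suc zero))
                  (≈-trans (+-cong (coordinates≈0 zero) (coordinates≈0 (suc (suc zero)))) (+-identityˡ 0#))
                  (≈-sym (cycle-four-relation w w-wc))

open import Data.Nat using (_+_)

mainTheorem4 : ∀ {c ℓ} (F : Field c ℓ) →
    (∀ n → 5 ≤ n → (w : Fin n → Field.Carrier F) → WellCovered F (PathAdj n) w →
      (∀ (i j : Fin n) → toℕ i ≡ 0 → toℕ j ≡ 1 → Field._≈_ F (w i) (w j))
      × (∀ (i : Fin n) → 2 ≤ toℕ i → toℕ i + 3 ≤ n → Field._≈_ F (w i) (Field.0# F))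
      × (∀ (i j : Fin n) → toℕ i ≡ n ∸ 2 → toℕ j ≡ n ∸ 1 → Field._≈_ F (w i) (w j)))
    × wcdim≡ F (PathAdj 2) 1
    × (∀ n → 3 ≤ n → wcdim≡ F (PathAdj n) 2)
    × (∀ n → 8 ≤ n → wcdim≡ F (CycleAdj n) 0)
    × wcdim≡ F (CycleAdj 3) 1
    × wcdim≡ F (CycleAdj 5) 1
    × wcdim≡ F (CycleAdj 7) 1
    × wcdim≡ F (CycleAdj 6) 2
    × wcdim≡ F (CycleAdj 4) 3
mainTheorem4 F =
    path-relations F
  , path-two-dimension F
  , path-dimension F
  , large-cycle-dimension F
  , cycle-three-dimension F
  , cycle-five-dimension F
  , cycle-seven-dimension F
  , cycle-six-dimension F
  , cycle-four-dimension F
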